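{- Let $p \ge 3$ be a prime with $p \equiv 3 \pmod 4$. Then $p$ has exactly one solution of the form $(x_1, x_1, z_1)$ (i.e. with $x = y$) and exactly one solution of the form $(x_2, y_2, y_2)$ (i.e. with $y = z$), and these satisfy $x_1 = 2x_2$ and $2z_1 = z_2$. If $p \ge 3$ is a prime with $p \not\equiv 3 \pmod 4$, then $p$ has no solution with $x = y$ and no solution with $y = z$.
   Context: For a positive integer $p$, a solution for $p$ is a triple $(x,y,z)$ of positive integers with $x \le y \le z$ and $\frac{4}{p} = \frac{1}{x} + \frac{1}{y} + \frac{1}{z}$. -}

module Defs where

open import Data.Nat using (ℕ; _+_; _*_; _≤_; _<_)
open import Data.Product using (_×_)
open import Relation.Binary.PropositionalEquality using (_≡_)

-- (x , y , z) is a solution for p: positive integers x ≤ y ≤ z with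
-- 4/p = 1/x + 1/y + 1/z, written with denominators cleared
-- (equivalent since p, x, y, z are positive): 4xyz = p(yz + xz + xy).
IsSolution : ℕ → ℕ → ℕ → ℕ → Set
IsSolution p x y z =
  (0 < x) × (x ≤ y) × (y ≤ z) ×
  (4 * (x * y * z) ≡ p * (y * z + x * z + x * y))

-- Since 4/p = 2/x + 1/z and 4/p = 1/x + 2/y, a solution with x = y gives
-- a solution (z, x/2) of the two-term equation 4/p = 1/a + 1/b, and one
-- with y = z gives (x, y/2); the halves are integers because p is odd.
-- For an odd prime p, 4ab = p(a + b) forces p to divide a or b, say b = kp;
-- then 4ak = a + kp, so a = mk with 4mk = m + p, whence m divides p and must
-- be 1.  Hence the two-term solutions are exactly {k, kp} with 4k = p + 1,
-- and the ordering x ≤ y ≤ z selects one arrangement in each case.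
module Submission where

open import Defs
open import Data.Nat using (ℕ; _*_; _≤_; _%_)
open import Data.Nat.Primality using (Prime)
open import Data.Product using (_×_; ∃-syntax)
open import Relation.Binary.PropositionalEquality using (_≡_; _≢_)
open import Relation.Nullary using (¬_)

open import Data.Nat using (suc; _+_; _<_; _≰_; _/_; z≤n; s≤s; >-nonZero)
open import Data.Nat.Properties
open import Data.Nat.DivMod using (m≡m%n+[m/n]*n; [m+kn]%n≡m%n)
open import Data.Nat.Divisibility
  using (_∣_; divides; divides-refl; ∣-refl; ∣-trans; ∣m+n∣m⇒∣n; ∣⇒≤; m∣m*n; n∣m*n)
open import Data.Nat.Primality using (prime[2]; euclidsLemma; prime⇒irreducible; prime⇒nonZero)
open import Data.Nat.Tactic.RingSolver using (solve)
open import Data.List using ([]; _∷_)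
open import Data.Product using (_,_)
open import Data.Sum using (_⊎_; inj₁; inj₂; reduce)
open import Relation.Binary.PropositionalEquality using (refl; sym; trans; cong; subst; module ≡-Reasoning)
open import Relation.Nullary using (contradiction)

open ≡-Reasoning

private variable a b c k m p x y z : ℕ

record IsSolution₂ (p a b : ℕ) : Set where
  constructor solution₂
  field equation : 4 * (a * b) ≡ p * (a + b)

IsSolution₂-sym : IsSolution₂ p a b → IsSolution₂ p b a
IsSolution₂-sym {p = p} {a = a} {b = b} (solution₂ e) = solution₂ (begin
  4 * (b * a)  ≡⟨ cong (4 *_) (*-comm b a) ⟩
  4 * (a * b)  ≡⟨ e ⟩
  p * (a + b)  ≡⟨ cong (p *_) (+-comm a b) ⟩
  p * (b + a)  ∎)

prime∣4*n⇒∣n : Prime p → 3 ≤ p → p ∣ 4 * m → p ∣ m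
prime∣4*n⇒∣n {m = m} pr 3≤p p∣4m with euclidsLemma 4 m pr p∣4m
... | inj₂ p∣m = p∣m
... | inj₁ p∣2*2 = contradiction (∣⇒≤ (reduce (euclidsLemma 2 2 pr p∣2*2))) (<⇒≱ 3≤p)

2∣p*n⇒2∣n : Prime p → 3 ≤ p → 2 ∣ p * m → 2 ∣ m
2∣p*n⇒2∣n {p = p} {m = m} pr 3≤p 2∣pm with euclidsLemma p m prime[2] 2∣pm
... | inj₂ 2∣m = 2∣m
... | inj₁ 2∣p with prime⇒irreducible pr 2∣p
...   | inj₂ refl = contradiction 3≤p (<-irrefl refl)

4mk≡m+p⇒m≡1 : Prime p → 4 * (m * k) ≡ m + p → (m ≡ 1) × (1 + p ≡ 4 * k)
4mk≡m+p⇒m≡1 {p = p} {m = m} {k = k} pr e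
  with prime⇒irreducible pr (∣m+n∣m⇒∣n (subst (m ∣_) e (∣-trans (m∣m*n k) (n∣m*n 4))) ∣-refl)
... | inj₁ refl = refl , trans (sym e) (cong (4 *_) (*-identityˡ k))
... | inj₂ refl = contradiction (∣⇒≤ (divides k (trans (sym 4k≡2) (*-comm 4 k)))) 4≰2
  where
  4≰2 : 4 ≰ 2
  4≰2 (s≤s (s≤s ()))
  4k≡2 : 4 * k ≡ 2
  4k≡2 = *-cancelˡ-≡ _ _ p {{prime⇒nonZero pr}} (begin
    p * (4 * k)    ≡⟨ solve (p ∷ k ∷ []) ⟩
    4 * (p * k)    ≡⟨ e ⟩
    p + p          ≡⟨ solve (p ∷ []) ⟩
    p * 2          ∎)

4ak≡a+kp⇒k∣a : 4 * (a * k) ≡ a + k * p → k ∣ a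
4ak≡a+kp⇒k∣a {a = a} {k = k} {p = p} e =
  ∣m+n∣m⇒∣n (subst (k ∣_) (trans e (+-comm a (k * p))) (∣-trans (n∣m*n a) (n∣m*n 4))) (m∣m*n p)

4ak≡a+kp⇒a≡k : Prime p → 0 < k → 4 * (a * k) ≡ a + k * p → (a ≡ k) × (1 + p ≡ 4 * k)
4ak≡a+kp⇒a≡k {p = p} {k = k} {a = a} pr 0<k e with 4ak≡a+kp⇒k∣a {a = a} {k = k} e
... | divides-refl m =
  let m≡1 , 1+p≡4k = 4mk≡m+p⇒m≡1 pr 4mk≡m+p
  in trans (cong (_* k) m≡1) (*-identityˡ k) , 1+p≡4k
  where
  4mk≡m+p : 4 * (m * k) ≡ m + p
  4mk≡m+p = *-cancelˡ-≡ _ _ k {{>-nonZero 0<k}} (begin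
    k * (4 * (m * k))  ≡⟨ solve (k ∷ m ∷ []) ⟩
    4 * (m * k * k)    ≡⟨ e ⟩
    m * k + k * p      ≡⟨ solve (m ∷ k ∷ p ∷ []) ⟩
    k * (m + p)        ∎)

IsSolution₂-multiple : Prime p → 0 < k * p → IsSolution₂ p a (k * p) → (a ≡ k) × (1 + p ≡ 4 * k)
IsSolution₂-multiple {p = p} {k = k} {a = a} pr 0<kp (solution₂ e) = 4ak≡a+kp⇒a≡k pr 0<k 4ak≡a+kp
  where
  0<k : 0 < k
  0<k = *-cancelʳ-< p 0 k 0<kp
  4ak≡a+kp : 4 * (a * k) ≡ a + k * p
  4ak≡a+kp = *-cancelˡ-≡ _ _ p {{prime⇒nonZero pr}} (begin
    p * (4 * (a * k))  ≡⟨ solve (p ∷ a ∷ k ∷ []) ⟩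
    4 * (a * (k * p))  ≡⟨ e ⟩
    p * (a + k * p)    ∎)

IsSolution₂-classify : Prime p → 3 ≤ p → 0 < a → 0 < b → IsSolution₂ p a b →
  ∃[ k ] (1 + p ≡ 4 * k) × ((a ≡ k × b ≡ k * p) ⊎ (a ≡ k * p × b ≡ k))
IsSolution₂-classify {p = p} {a = a} {b = b} pr 3≤p 0<a 0<b s@(solution₂ e)
  with euclidsLemma a b pr (prime∣4*n⇒∣n pr 3≤p (divides (a + b) (trans e (*-comm p (a + b)))))
... | inj₂ (divides-refl k) =
  let a≡k , 1+p≡4k = IsSolution₂-multiple pr 0<b s in k , 1+p≡4k , inj₁ (a≡k , refl)
... | inj₁ (divides-refl k) =
  let b≡k , 1+p≡4k = IsSolution₂-multiple pr 0<a (IsSolution₂-sym s) in k , 1+p≡4k , inj₂ (refl , b≡k)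

4ac≡p[c+2a]⇒2∣c : Prime p → 3 ≤ p → 4 * (a * c) ≡ p * (c + 2 * a) → 2 ∣ c
4ac≡p[c+2a]⇒2∣c {p = p} {a = a} {c = c} pr 3≤p e =
  2∣p*n⇒2∣n pr 3≤p (∣m+n∣m⇒∣n (divides (2 * (a * c)) 2pa+pc≡2ac*2) (m∣m*n (p * a)))
  where
  2pa+pc≡2ac*2 : 2 * (p * a) + p * c ≡ 2 * (a * c) * 2
  2pa+pc≡2ac*2 = begin
    2 * (p * a) + p * c  ≡⟨ solve (p ∷ a ∷ c ∷ []) ⟩
    p * (c + 2 * a)      ≡⟨ sym e ⟩
    4 * (a * c)          ≡⟨ solve (a ∷ c ∷ []) ⟩
    2 * (a * c) * 2      ∎

4ac≡p[c+2a]⇒IsSolution₂ : Prime p → 3 ≤ p → 4 * (a * c) ≡ p * (c + 2 * a) →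
  ∃[ b ] (c ≡ 2 * b) × IsSolution₂ p a b
4ac≡p[c+2a]⇒IsSolution₂ {p = p} {a = a} {c = c} pr 3≤p e
  with 4ac≡p[c+2a]⇒2∣c {a = a} {c = c} pr 3≤p e
... | divides-refl b = b , *-comm b 2 , solution₂ (*-cancelˡ-≡ _ _ 2 (begin
  2 * (4 * (a * b))    ≡⟨ solve (a ∷ b ∷ []) ⟩
  4 * (a * (b * 2))    ≡⟨ e ⟩
  p * (b * 2 + 2 * a)  ≡⟨ solve (p ∷ a ∷ b ∷ []) ⟩
  2 * (p * (a + b))    ∎))

x≡y-equation : IsSolution p x x z → 4 * (z * x) ≡ p * (x + 2 * z)
x≡y-equation {p = p} {x = x} {z = z} (0<x , _ , _ , e) =
  *-cancelˡ-≡ _ _ x {{>-nonZero 0<x}} (begin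
    x * (4 * (z * x))            ≡⟨ solve (x ∷ z ∷ []) ⟩
    4 * (x * x * z)              ≡⟨ e ⟩
    p * (x * z + x * z + x * x)  ≡⟨ solve (p ∷ x ∷ z ∷ []) ⟩
    x * (p * (x + 2 * z))        ∎)

y≡z-equation : IsSolution p x y y → 4 * (x * y) ≡ p * (y + 2 * x)
y≡z-equation {p = p} {x = x} {y = y} (0<x , x≤y , _ , e) =
  *-cancelˡ-≡ _ _ y {{>-nonZero (<-≤-trans 0<x x≤y)}} (begin
    y * (4 * (x * y))            ≡⟨ solve (x ∷ y ∷ []) ⟩
    4 * (x * y * y)              ≡⟨ e ⟩
    p * (y * y + x * y + x * y)  ≡⟨ solve (p ∷ x ∷ y ∷ []) ⟩
    y * (p * (y + 2 * x))        ∎)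

x≡y⇒IsSolution₂ : Prime p → 3 ≤ p → IsSolution p x x z → ∃[ a ] (x ≡ 2 * a) × IsSolution₂ p z a
x≡y⇒IsSolution₂ {p = p} {x = x} {z = z} pr 3≤p s =
  4ac≡p[c+2a]⇒IsSolution₂ {a = z} {c = x} pr 3≤p (x≡y-equation {p = p} s)

y≡z⇒IsSolution₂ : Prime p → 3 ≤ p → IsSolution p x y y → ∃[ b ] (y ≡ 2 * b) × IsSolution₂ p x b
y≡z⇒IsSolution₂ {p = p} {x = x} {y = y} pr 3≤p s =
  4ac≡p[c+2a]⇒IsSolution₂ {a = x} {c = y} pr 3≤p (y≡z-equation {p = p} s)

k*p≰2*k : 3 ≤ p → 0 < k → k * p ≰ 2 * k
k*p≰2*k {p = p} {k = k} 3≤p 0<k kp≤2k =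
  <⇒≱ 3≤p (*-cancelˡ-≤ k {{>-nonZero 0<k}} (subst (k * p ≤_) (*-comm 2 k) kp≤2k))

x≡y-solution⇒ : Prime p → 3 ≤ p → IsSolution p x x z →
  ∃[ k ] (1 + p ≡ 4 * k) × (x ≡ 2 * k) × (z ≡ k * p)
x≡y-solution⇒ {p = p} pr 3≤p s@(0<x , _ , x≤z , _) with x≡y⇒IsSolution₂ pr 3≤p s
... | a , refl , e with IsSolution₂-classify pr 3≤p (<-≤-trans 0<x x≤z) (*-cancelˡ-< 2 0 a 0<x) e
...   | k , 1+p≡4k , inj₂ (refl , refl) = k , 1+p≡4k , refl , refl
...   | k , _ , inj₁ (refl , refl) =
  contradiction (≤-trans (m≤n*m (k * p) 2) (≤-trans x≤z (m≤n*m k 2))) (k*p≰2*k 3≤p (<-≤-trans 0<x x≤z))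

y≡z-solution⇒ : Prime p → 3 ≤ p → IsSolution p x y y →
  ∃[ k ] (1 + p ≡ 4 * k) × (x ≡ k) × (y ≡ 2 * (k * p))
y≡z-solution⇒ pr 3≤p s@(0<x , x≤y , _ , _) with y≡z⇒IsSolution₂ pr 3≤p s
... | b , refl , e with IsSolution₂-classify pr 3≤p 0<x (*-cancelˡ-< 2 0 b (<-≤-trans 0<x x≤y)) e
...   | k , 1+p≡4k , inj₁ (refl , refl) = k , 1+p≡4k , refl , refl
...   | k , _ , inj₂ (refl , refl) =
  contradiction x≤y (k*p≰2*k 3≤p (*-cancelˡ-< 2 0 k (<-≤-trans 0<x x≤y)))

1+p≡4k⇒0<k : 1 + p ≡ 4 * k → 0 < k
1+p≡4k⇒0<k {k = suc _} _ = s≤s z≤n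

x≡y-solution : 2 ≤ p → 1 + p ≡ 4 * k → IsSolution p (2 * k) (2 * k) (k * p)
x≡y-solution {p = p} {k = k} 2≤p 1+p≡4k =
    m<n⇒m<o*n 2 (1+p≡4k⇒0<k {k = k} 1+p≡4k)
  , ≤-refl
  , subst (_≤ k * p) (*-comm k 2) (*-monoʳ-≤ k 2≤p)
  , (begin
    4 * (2 * k * (2 * k) * (k * p))                        ≡⟨ solve (k ∷ p ∷ []) ⟩
    4 * (k * k * p) * (4 * k)                              ≡⟨ cong (4 * (k * k * p) *_) (sym 1+p≡4k) ⟩
    4 * (k * k * p) * (1 + p)                              ≡⟨ solve (k ∷ p ∷ []) ⟩
    p * (2 * k * (k * p) + 2 * k * (k * p) + 2 * k * (2 * k)) ∎)

y≡z-solution : 0 < p → 1 + p ≡ 4 * k → IsSolution p k (2 * (k * p)) (2 * (k * p))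
y≡z-solution {p = p} {k = k} 0<p 1+p≡4k =
    1+p≡4k⇒0<k {k = k} 1+p≡4k
  , ≤-trans (m≤m*n k p {{>-nonZero 0<p}}) (m≤n*m (k * p) 2)
  , ≤-refl
  , (begin
    4 * (k * (2 * (k * p)) * (2 * (k * p)))                  ≡⟨ solve (k ∷ p ∷ []) ⟩
    4 * (k * p * (k * p)) * (4 * k)                          ≡⟨ cong (4 * (k * p * (k * p)) *_) (sym 1+p≡4k) ⟩
    4 * (k * p * (k * p)) * (1 + p)                          ≡⟨ solve (k ∷ p ∷ []) ⟩
    p * (2 * (k * p) * (2 * (k * p)) + k * (2 * (k * p)) + k * (2 * (k * p))) ∎)

x≡y-solution-unique : Prime p → 3 ≤ p → 1 + p ≡ 4 * k → IsSolution p x x z → (x ≡ 2 * k) × (z ≡ k * p)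
x≡y-solution-unique {k = k} pr 3≤p 1+p≡4k s with x≡y-solution⇒ pr 3≤p s
... | k′ , 1+p≡4k′ , refl , refl with *-cancelˡ-≡ k′ k 4 (trans (sym 1+p≡4k′) 1+p≡4k)
...   | refl = refl , refl

y≡z-solution-unique : Prime p → 3 ≤ p → 1 + p ≡ 4 * k → IsSolution p x y y → (x ≡ k) × (y ≡ 2 * (k * p))
y≡z-solution-unique {k = k} pr 3≤p 1+p≡4k s with y≡z-solution⇒ pr 3≤p s
... | k′ , 1+p≡4k′ , refl , refl with *-cancelˡ-≡ k′ k 4 (trans (sym 1+p≡4k′) 1+p≡4k)
...   | refl = refl , refl

p%4≡3⇒1+p≡4k : p % 4 ≡ 3 → 1 + p ≡ 4 * suc (p / 4)
p%4≡3⇒1+p≡4k {p = p} p%4≡3 = begin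
  1 + p                        ≡⟨ cong suc (m≡m%n+[m/n]*n p 4) ⟩
  1 + (p % 4 + p / 4 * 4)      ≡⟨ cong (λ r → 1 + (r + p / 4 * 4)) p%4≡3 ⟩
  4 + p / 4 * 4                ≡⟨ cong (4 +_) (*-comm (p / 4) 4) ⟩
  4 + 4 * (p / 4)              ≡⟨ sym (*-suc 4 (p / 4)) ⟩
  4 * suc (p / 4)              ∎

1+p≡4k⇒p%4≡3 : 1 + p ≡ 4 * k → p % 4 ≡ 3
1+p≡4k⇒p%4≡3 {p = p} {k = suc j} 1+p≡4k = trans (cong (_% 4) p≡3+j*4) ([m+kn]%n≡m%n 3 j 4)
  where
  p≡3+j*4 : p ≡ 3 + j * 4
  p≡3+j*4 = suc-injective (begin
    1 + p          ≡⟨ 1+p≡4k ⟩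
    4 * suc j      ≡⟨ solve (j ∷ []) ⟩
    1 + (3 + j * 4) ∎)

mainTheorem6 : (p : ℕ) → Prime p → 3 ≤ p →
    (p % 4 ≡ 3 →
      ∃[ x₁ ] ∃[ z₁ ] ∃[ x₂ ] ∃[ y₂ ]
        (IsSolution p x₁ x₁ z₁
          × (∀ x z → IsSolution p x x z → (x ≡ x₁) × (z ≡ z₁))
          × IsSolution p x₂ y₂ y₂
          × (∀ x y → IsSolution p x y y → (x ≡ x₂) × (y ≡ y₂))
          × (x₁ ≡ 2 * x₂)
          × (2 * z₁ ≡ y₂)))
    × (p % 4 ≢ 3 →
      (∀ x z → ¬ IsSolution p x x z) × (∀ x y → ¬ IsSolution p x y y))
mainTheorem6 p pr 3≤p =
    (λ p%4≡3 → let 1+p≡4k = p%4≡3⇒1+p≡4k p%4≡3 in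
        2 * suc (p / 4) , suc (p / 4) * p , suc (p / 4) , 2 * (suc (p / 4) * p)
      , x≡y-solution (<⇒≤ 3≤p) 1+p≡4k , (λ _ _ → x≡y-solution-unique pr 3≤p 1+p≡4k)
      , y≡z-solution (≤-trans (s≤s z≤n) 3≤p) 1+p≡4k , (λ _ _ → y≡z-solution-unique pr 3≤p 1+p≡4k)
      , refl , refl)
  , λ p%4≢3 →
      (λ _ _ s → let k , 1+p≡4k , _ = x≡y-solution⇒ pr 3≤p s in p%4≢3 (1+p≡4k⇒p%4≡3 {k = k} 1+p≡4k))
    , (λ _ _ s → let k , 1+p≡4k , _ = y≡z-solution⇒ pr 3≤p s in p%4≢3 (1+p≡4k⇒p%4≡3 {k = k} 1+p≡4k))
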